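{- Let $n\ge 2$ be an integer. If $\varphi$ is an edge precoloring of $K_{2n-1} \square K_2$ with colors from $\{1,\dots,2n\}$ and with $n+1$ precolored edges, where at least $n$ of the precolored edges have the same color, then $\varphi$ is extendable to a proper $2n$-edge coloring of $K_{2n-1}\square K_2$.
   Context: $G \square H$ denotes the cartesian product of graphs $G$ and $H$. An edge precoloring of a graph is a proper edge coloring of some subset of its edges. A precoloring $\varphi$ is extendable to a proper $t$-edge coloring if there is a proper edge coloring $f$ with colors $\{1,\dots,t\}$ such that $f(e)=\varphi(e)$ for every edge $e$ colored under $\varphi$. -}

module Defs where

open import Data.Nat using (ℕ; suc; _+_; _*_; _∸_; _≤_)
open import Data.Fin using (Fin)
open import Data.Product using (_×_; _,_; Σ; ∃; proj₁; proj₂)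
open import Data.Sum using (_⊎_)
open import Data.List using (List; length; filter)
open import Data.List.Relation.Unary.AllPairs using (AllPairs)
open import Data.List.Membership.Propositional using (_∈_)
open import Relation.Binary.PropositionalEquality using (_≡_; _≢_)
open import Relation.Nullary using (¬_)
open import Data.Fin using (_≟_)

Vertex : ℕ → Set
Vertex m = Fin m × Fin 2

Adj : ∀ {m} → Vertex m → Vertex m → Set
Adj (u , a) (v , b) = (a ≡ b × u ≢ v) ⊎ (u ≡ v × a ≢ b)

-- Proper t-edge coloring of K_m □ K_2: a color in Fin t for every edge
-- (given on ordered adjacent pairs, required symmetric so that it is a
-- function on unordered edges), with edges sharing an endpoint getting
-- distinct colors.
record ProperEdgeColoring (m t : ℕ) : Set where
  field
    col   : (x y : Vertex m) → Adj x y → Fin t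
    sym   : ∀ x y (p : Adj x y) (q : Adj y x) → col x y p ≡ col y x q
    proper : ∀ x y z (p : Adj x y) (q : Adj x z) → y ≢ z → col x y p ≢ col x z q
open ProperEdgeColoring public

record PEdge (m t : ℕ) : Set where
  constructor pedge
  field
    src : Vertex m
    tgt : Vertex m
    adj : Adj src tgt
    clr : Fin t
open PEdge public

SameEdge : ∀ {m t} → PEdge m t → PEdge m t → Set
SameEdge e f = (src e ≡ src f × tgt e ≡ tgt f) ⊎ (src e ≡ tgt f × tgt e ≡ src f)

ShareEnd : ∀ {m t} → PEdge m t → PEdge m t → Set
ShareEnd e f = (src e ≡ src f) ⊎ (src e ≡ tgt f) ⊎ (tgt e ≡ src f) ⊎ (tgt e ≡ tgt f)

-- An edge precoloring: a list of precolored edges, pairwise distinct as edges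
-- (so its length is the number of precolored edges), and proper: distinct
-- precolored edges sharing an endpoint receive distinct colors.
Compatible : ∀ {m t} → PEdge m t → PEdge m t → Set
Compatible e f = ¬ SameEdge e f × (ShareEnd e f → clr e ≢ clr f)

IsPrecoloring : ∀ {m t} → List (PEdge m t) → Set
IsPrecoloring = AllPairs Compatible

countColor : ∀ {m t} → Fin t → List (PEdge m t) → ℕ
countColor c es = length (filter (λ e → clr e ≟ c) es)

Extends : ∀ {m t} → ProperEdgeColoring m t → List (PEdge m t) → Set
Extends {m} {t} f es = ∀ e → e ∈ es → col f (src e) (tgt e) (adj e) ≡ clr e

Extendable : (m t : ℕ) → List (PEdge m t) → Set
Extendable m t es = Σ (ProperEdgeColoring m t) (λ f → Extends f es)

{-# OPTIONS --safe #-}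
module Submission where

-- K_m □ K_2 has a proper m-edge-colouring (u,a)(v,a) ↦ u + v, (u,0)(u,1) ↦ 2u mod m.
-- With 2n = m + 1 colours one colour c is spare: compose the base colouring with an
-- injection Fin m → Fin (m+1) that avoids c, chosen (via a transposition) to give the
-- single edge not precoloured c its prescribed colour. The precoloured c-edges form a
-- matching and c is unused elsewhere, so overriding the colouring on them stays proper.

open import Defs
open import Data.Nat using (ℕ; suc; _+_; _*_; _∸_; _≤_; _<_; s≤s; NonZero)
open import Data.Nat.Properties using (+-comm; +-assoc; m∸n+n≡m; ≤-trans; <-irrefl; ≤-pred)
open import Data.Nat.DivMod using (_%_; _mod_; %-distribˡ-+; m%n%n≡m%n; [m+n]%n≡m%n; m<n⇒m%n≡m)
open import Data.Fin using (Fin; zero; suc; toℕ; _≟_; punchIn; punchOut)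
open import Data.Fin.Properties
  using (toℕ-injective; toℕ-fromℕ<; toℕ<n; toℕ≤n; punchIn-injective; punchInᵢ≢i; punchIn-punchOut)
open import Data.Fin.Permutation.Components using (transpose; transpose-inverse)
open import Data.List using (List; _∷_; length; filter)
open import Data.List.Properties using (filter-notAll)
open import Data.List.Relation.Unary.All as All using (all?)
open import Data.List.Relation.Unary.All.Properties using (¬All⇒Any¬)
open import Data.List.Relation.Unary.Any using (Any; here; there; any?)
open import Data.List.Relation.Unary.AllPairs using (AllPairs; _∷_)
open import Data.List.Membership.Propositional using (_∈_; find; lose)
open import Data.Product using (∃; _×_; _,_; proj₁; uncurry)
open import Data.Product.Properties using (≡-dec)
open import Data.Sum using (_⊎_; inj₁; inj₂; [_,_])
open import Function using (_∘_)
open import Function.Definitions using (Injective)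
open import Relation.Nullary using (¬_; Dec; yes; no; contradiction)
open import Relation.Nullary.Decidable using (map′; _×-dec_; _⊎-dec_)
open import Relation.Unary using (Decidable)
open import Relation.Binary.PropositionalEquality as ≡ using (_≡_; _≢_; refl; trans; cong; subst; module ≡-Reasoning)

private
  variable
    m t : ℕ

allPairs-∈ : ∀ {A : Set} {R : A → A → Set} {xs : List A} → AllPairs R xs →
             ∀ {x y} → x ∈ xs → y ∈ xs → x ≡ y ⊎ R x y ⊎ R y x
allPairs-∈ (_ ∷ _)      (here refl) (here refl) = inj₁ refl
allPairs-∈ (rx ∷ _)     (here refl) (there y∈) = inj₂ (inj₁ (All.lookup rx y∈))
allPairs-∈ (ry ∷ _)     (there x∈) (here refl) = inj₂ (inj₂ (All.lookup ry x∈))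
allPairs-∈ (_ ∷ pairs) (there x∈) (there y∈) = allPairs-∈ pairs x∈ y∈

filter-rejects-atMostOne : ∀ {A : Set} {P : A → Set} (P? : Decidable P) (xs : List A) →
  length xs ≤ suc (length (filter P? xs)) →
  ∀ {x y} → x ∈ xs → y ∈ xs → ¬ P x → ¬ P y → x ≡ y
filter-rejects-atMostOne {P = P} P? (z ∷ zs) bound x∈ y∈ ¬Px ¬Py with P? z
... | yes Pz with x∈ | y∈
...   | here refl | _         = contradiction Pz ¬Px
...   | there _   | here refl = contradiction Pz ¬Py
...   | there x∈′ | there y∈′ = filter-rejects-atMostOne P? zs (≤-pred bound) x∈′ y∈′ ¬Px ¬Py
filter-rejects-atMostOne {P = P} P? (z ∷ zs) bound x∈ y∈ ¬Px ¬Py | no _ =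
  trans (isHead x∈ ¬Px) (≡.sym (isHead y∈ ¬Py))
  where
  -- all of zs passes the filter, so only the head can be rejected
  isHead : ∀ {x} → x ∈ z ∷ zs → ¬ P x → x ≡ z
  isHead (here refl) _ = refl
  isHead (there x∈) ¬Px =
    contradiction (≤-trans (filter-notAll P? zs (lose x∈ ¬Px)) (≤-pred bound)) (<-irrefl refl)

[m∸n+[n+o]%m]%m≡o : ∀ m n o .{{_ : NonZero m}} → n ≤ m → o < m → (m ∸ n + (n + o) % m) % m ≡ o
[m∸n+[n+o]%m]%m≡o m n o n≤m o<m = begin
  (m ∸ n + (n + o) % m) % m           ≡⟨ %-distribˡ-+ (m ∸ n) ((n + o) % m) m ⟩
  ((m ∸ n) % m + (n + o) % m % m) % m ≡⟨ cong (λ r → ((m ∸ n) % m + r) % m) (m%n%n≡m%n (n + o) m) ⟩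
  ((m ∸ n) % m + (n + o) % m) % m     ≡⟨ %-distribˡ-+ (m ∸ n) (n + o) m ⟨
  (m ∸ n + (n + o)) % m               ≡⟨ cong (_% m) (+-assoc (m ∸ n) n o) ⟨
  (m ∸ n + n + o) % m                 ≡⟨ cong (λ r → (r + o) % m) (m∸n+n≡m n≤m) ⟩
  (m + o) % m                         ≡⟨ cong (_% m) (+-comm m o) ⟩
  (o + m) % m                         ≡⟨ [m+n]%n≡m%n o m ⟩
  o % m                               ≡⟨ m<n⇒m%n≡m o<m ⟩
  o                                   ∎
  where open ≡-Reasoning

_+ₘ_ : Fin m → Fin m → Fin m
_+ₘ_ {suc m} u v = (toℕ u + toℕ v) mod suc m

+ₘ-comm : (u v : Fin m) → u +ₘ v ≡ v +ₘ u
+ₘ-comm {suc m} u v = cong (_mod suc m) (+-comm (toℕ u) (toℕ v))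

+ₘ-cancelˡ : (u : Fin m) {v w : Fin m} → u +ₘ v ≡ u +ₘ w → v ≡ w
+ₘ-cancelˡ {suc m} u {v} {w} eq = toℕ-injective (begin
  toℕ v                                          ≡⟨ undoAdd v ⟨
  (suc m ∸ toℕ u + toℕ (u +ₘ v)) % suc m         ≡⟨ cong (λ r → (suc m ∸ toℕ u + toℕ r) % suc m) eq ⟩
  (suc m ∸ toℕ u + toℕ (u +ₘ w)) % suc m         ≡⟨ undoAdd w ⟩
  toℕ w                                          ∎)
  where
  open ≡-Reasoning
  undoAdd : ∀ v → (suc m ∸ toℕ u + toℕ (u +ₘ v)) % suc m ≡ toℕ v
  undoAdd v = trans (cong (λ r → (suc m ∸ toℕ u + r) % suc m) (toℕ-fromℕ< _))
                    ([m∸n+[n+o]%m]%m≡o (suc m) (toℕ u) (toℕ v) (toℕ≤n u) (toℕ<n v))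

transpose-sendsˡ : ∀ {n} (i j : Fin n) → transpose i j i ≡ j
transpose-sendsˡ i j with i ≟ i
... | yes _   = refl
... | no i≢i = contradiction refl i≢i

transpose-injective : ∀ {n} (i j : Fin n) → Injective _≡_ _≡_ (transpose i j)
transpose-injective i j {k} {k′} eq = begin
  k                                ≡⟨ transpose-inverse j i ⟨
  transpose j i (transpose i j k)  ≡⟨ cong (transpose j i) eq ⟩
  transpose j i (transpose i j k′) ≡⟨ transpose-inverse j i ⟩
  k′                               ∎
  where open ≡-Reasoning

AvoidingInjection : (c : Fin (suc m)) → (Fin m → Fin (suc m)) → Set
AvoidingInjection c σ = Injective _≡_ _≡_ σ × (∀ k → σ k ≢ c)

punchIn-avoiding : (c : Fin (suc m)) → AvoidingInjection c (punchIn c)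
punchIn-avoiding c = punchIn-injective c _ _ , punchInᵢ≢i c

avoidingInjection-sending : {c d : Fin (suc m)} → c ≢ d → (k : Fin m) →
  ∃ λ σ → AvoidingInjection c σ × σ k ≡ d
avoidingInjection-sending {c = c} {d} c≢d k =
  punchIn c ∘ transpose k j ,
  (transpose-injective k j ∘ punchIn-injective c _ _ , punchInᵢ≢i c ∘ transpose k j) ,
  trans (cong (punchIn c) (transpose-sendsˡ k j)) (punchIn-punchOut c≢d)
  where
  j : Fin _
  j = punchOut c≢d

Fin2-≢⇒≡ : {a b c : Fin 2} → a ≢ b → a ≢ c → b ≡ c
Fin2-≢⇒≡ {zero}     {zero}                 a≢b _   = contradiction refl a≢b
Fin2-≢⇒≡ {zero}     {suc zero} {zero}     _   a≢c = contradiction refl a≢c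
Fin2-≢⇒≡ {zero}     {suc zero} {suc zero} _   _   = refl
Fin2-≢⇒≡ {suc zero} {zero}     {zero}     _   _   = refl
Fin2-≢⇒≡ {suc zero} {zero}     {suc zero} _   a≢c = contradiction refl a≢c
Fin2-≢⇒≡ {suc zero} {suc zero}             a≢b _   = contradiction refl a≢b

Adj-sym : {x y : Vertex m} → Adj x y → Adj y x
Adj-sym (inj₁ (a≡b , u≢v)) = inj₁ (≡.sym a≡b , u≢v ∘ ≡.sym)
Adj-sym (inj₂ (u≡v , a≢b)) = inj₂ (≡.sym u≡v , a≢b ∘ ≡.sym)

Adj-irrefl : (x : Vertex m) → ¬ Adj x x
Adj-irrefl _ (inj₁ (_ , u≢u)) = u≢u refl
Adj-irrefl _ (inj₂ (_ , a≢a)) = a≢a refl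

col-irrelevant : (f : ProperEdgeColoring m t) {x y : Vertex m} (p q : Adj x y) → col f x y p ≡ col f x y q
col-irrelevant f {x} {y} p q = trans (sym f x y p (Adj-sym p)) (≡.sym (sym f x y q (Adj-sym p)))

recolor : ∀ {s} (σ : Fin s → Fin t) → Injective _≡_ _≡_ σ → ProperEdgeColoring m s → ProperEdgeColoring m t
recolor σ σ-injective f = record
  { col    = λ x y p → σ (col f x y p)
  ; sym    = λ x y p q → cong σ (sym f x y p q)
  ; proper = λ x y z p q y≢z → proper f x y z p q y≢z ∘ σ-injective
  }

module LatinSquareColoring (L : Fin m → Fin m → Fin m)
  (L-comm : ∀ u v → L u v ≡ L v u) (L-cancelˡ : ∀ u {v w} → L u v ≡ L u w → v ≡ w) where

  latinCol : (x y : Vertex m) → Adj x y → Fin m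
  latinCol (u , _) (v , _) (inj₁ _) = L u v
  latinCol (u , _) _       (inj₂ _) = L u u

  latinCol-sym : ∀ x y (p : Adj x y) (q : Adj y x) → latinCol x y p ≡ latinCol y x q
  latinCol-sym (u , _) (v , _) (inj₁ _)           (inj₁ _)           = L-comm u v
  latinCol-sym _       _       (inj₂ (refl , _))  (inj₂ _)           = refl
  latinCol-sym _       _       (inj₁ (a≡b , _))   (inj₂ (_ , b≢a))   = contradiction (≡.sym a≡b) b≢a
  latinCol-sym _       _       (inj₂ (_ , a≢b))   (inj₁ (b≡a , _))   = contradiction (≡.sym b≡a) a≢b

  latinCol-proper : ∀ x y z (p : Adj x y) (q : Adj x z) → y ≢ z → latinCol x y p ≢ latinCol x z q
  latinCol-proper (u , _) _ _ (inj₁ (refl , _))   (inj₁ (refl , _))   y≢z = y≢z ∘ cong (_, _) ∘ L-cancelˡ u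
  latinCol-proper (u , _) _ _ (inj₁ (refl , u≢v)) (inj₂ (refl , _))   _   = u≢v ∘ ≡.sym ∘ L-cancelˡ u
  latinCol-proper (u , _) _ _ (inj₂ (refl , _))   (inj₁ (refl , u≢w)) _   = u≢w ∘ L-cancelˡ u
  latinCol-proper (u , _) _ _ (inj₂ (refl , a≢b)) (inj₂ (refl , a≢c)) y≢z =
    λ _ → y≢z (cong (u ,_) (Fin2-≢⇒≡ a≢b a≢c))

  latinColoring : ProperEdgeColoring m m
  latinColoring = record { col = latinCol ; sym = latinCol-sym ; proper = latinCol-proper }

baseColoring : ProperEdgeColoring m m
baseColoring = LatinSquareColoring.latinColoring _+ₘ_ +ₘ-comm +ₘ-cancelˡ

data Joins (e : PEdge m t) (x y : Vertex m) : Set where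
  forwards  : src e ≡ x → tgt e ≡ y → Joins e x y
  backwards : src e ≡ y → tgt e ≡ x → Joins e x y

joins? : (e : PEdge m t) (x y : Vertex m) → Dec (Joins e x y)
joins? e x y = map′ [ uncurry forwards , uncurry backwards ] toSum
  ((src e ≟ᵥ x ×-dec tgt e ≟ᵥ y) ⊎-dec (src e ≟ᵥ y ×-dec tgt e ≟ᵥ x))
  where
  _≟ᵥ_ : ∀ {k} (v w : Vertex k) → Dec (v ≡ w)
  _≟ᵥ_ = ≡-dec _≟_ _≟_
  toSum : Joins e x y → (src e ≡ x × tgt e ≡ y) ⊎ (src e ≡ y × tgt e ≡ x)
  toSum (forwards s t)  = inj₁ (s , t)
  toSum (backwards s t) = inj₂ (s , t)

joins-self : (e : PEdge m t) → Joins e (src e) (tgt e)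
joins-self e = forwards refl refl

joins-sym : {e : PEdge m t} {x y : Vertex m} → Joins e x y → Joins e y x
joins-sym (forwards s t)  = backwards s t
joins-sym (backwards s t) = forwards s t

joins-functional : {e : PEdge m t} {x y z : Vertex m} → Adj x y → Joins e x y → Joins e x z → y ≡ z
joins-functional _ (forwards _ t)  (forwards _ t′)  = trans (≡.sym t) t′
joins-functional _ (backwards s _) (backwards s′ _) = trans (≡.sym s) s′
joins-functional {x = x} p (forwards _ t) (backwards _ t′) =
  contradiction (subst (Adj x) (trans (≡.sym t) t′) p) (Adj-irrefl x)
joins-functional {x = x} p (backwards s _) (forwards s′ _) =
  contradiction (subst (Adj x) (trans (≡.sym s) s′) p) (Adj-irrefl x)

joins-sameEdge : {e e′ : PEdge m t} {x y : Vertex m} → Joins e x y → Joins e′ x y → SameEdge e e′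
joins-sameEdge (forwards s t)  (forwards s′ t′)  = inj₁ (trans s (≡.sym s′) , trans t (≡.sym t′))
joins-sameEdge (forwards s t)  (backwards s′ t′) = inj₂ (trans s (≡.sym t′) , trans t (≡.sym s′))
joins-sameEdge (backwards s t) (forwards s′ t′)  = inj₂ (trans s (≡.sym t′) , trans t (≡.sym s′))
joins-sameEdge (backwards s t) (backwards s′ t′) = inj₁ (trans s (≡.sym s′) , trans t (≡.sym t′))

joins-shareEnd : {e e′ : PEdge m t} {x y z : Vertex m} → Joins e x y → Joins e′ x z → ShareEnd e e′
joins-shareEnd (forwards s _)  (forwards s′ _)  = inj₁ (trans s (≡.sym s′))
joins-shareEnd (forwards s _)  (backwards _ t′) = inj₂ (inj₁ (trans s (≡.sym t′)))
joins-shareEnd (backwards _ t) (forwards s′ _)  = inj₂ (inj₂ (inj₁ (trans t (≡.sym s′))))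
joins-shareEnd (backwards _ t) (backwards _ t′) = inj₂ (inj₂ (inj₂ (trans t (≡.sym t′))))

col-joins : (f : ProperEdgeColoring m t) {e : PEdge m t} {x y : Vertex m} →
            Joins e x y → (p : Adj x y) → col f (src e) (tgt e) (adj e) ≡ col f x y p
col-joins f {e} (forwards refl refl)  p = col-irrelevant f (adj e) p
col-joins f {e} (backwards refl refl) p = ≡.sym (sym f _ _ p (adj e))

Admissible : ProperEdgeColoring m t → PEdge m t → Set
Admissible {m} f e = col f (src e) (tgt e) (adj e) ≡ clr e ⊎ (∀ x y (p : Adj {m} x y) → col f x y p ≢ clr e)

admissible-≢ : (f : ProperEdgeColoring m t) {e : PEdge m t} → Admissible f e →
  ∀ {x y z} → Joins e x y → (p : Adj x y) (q : Adj x z) → y ≢ z → clr e ≢ col f x z q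
admissible-≢ f (inj₁ asBefore) j p q y≢z =
  proper f _ _ _ p q y≢z ∘ trans (trans (≡.sym (col-joins f j p)) asBefore)
admissible-≢ f (inj₂ unused)   _ _ q _   = unused _ _ q ∘ ≡.sym

module Override (f : ProperEdgeColoring m t) (φ : List (PEdge m t))
  (φ-precoloring : IsPrecoloring φ) (φ-admissible : ∀ {e} → e ∈ φ → Admissible f e) where

  precolored-unique : ∀ {e e′ x y} → e ∈ φ → e′ ∈ φ → Joins e x y → Joins e′ x y → e ≡ e′
  precolored-unique e∈ e′∈ j j′ with allPairs-∈ φ-precoloring e∈ e′∈
  ... | inj₁ e≡e′                 = e≡e′
  ... | inj₂ (inj₁ (notSame , _)) = contradiction (joins-sameEdge j j′) notSame
  ... | inj₂ (inj₂ (notSame , _)) = contradiction (joins-sameEdge j′ j) notSame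

  precolored-proper : ∀ {e e′ x y z} → e ∈ φ → e′ ∈ φ → Joins e x y → Joins e′ x z →
                      Adj x y → y ≢ z → clr e ≢ clr e′
  precolored-proper e∈ e′∈ j j′ p y≢z with allPairs-∈ φ-precoloring e∈ e′∈
  ... | inj₁ refl                = λ _ → y≢z (joins-functional p j j′)
  ... | inj₂ (inj₁ (_ , distinct)) = distinct (joins-shareEnd j j′)
  ... | inj₂ (inj₂ (_ , distinct)) = distinct (joins-shareEnd j′ j) ∘ ≡.sym

  overrideCol : (x y : Vertex m) → Adj x y → Fin t
  overrideCol x y p with any? (λ e → joins? e x y) φ
  ... | yes joined = clr (proj₁ (find joined))
  ... | no _       = col f x y p

  data OverrideView (x y : Vertex m) (p : Adj x y) : Fin t → Set where
    precolored : ∀ {e} → e ∈ φ → Joins e x y → OverrideView x y p (clr e)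
    inherited  : ¬ Any (λ e → Joins e x y) φ → OverrideView x y p (col f x y p)

  overrideView : ∀ x y p → OverrideView x y p (overrideCol x y p)
  overrideView x y p with any? (λ e → joins? e x y) φ
  ... | yes joined = let _ , e∈ , j = find joined in precolored e∈ j
  ... | no unjoined = inherited unjoined

  overrideCol-sym : ∀ x y (p : Adj x y) (q : Adj y x) → overrideCol x y p ≡ overrideCol y x q
  overrideCol-sym x y p q with overrideCol x y p | overrideView x y p | overrideCol y x q | overrideView y x q
  ... | _ | precolored e∈ j  | _ | precolored e′∈ j′ = cong clr (precolored-unique e∈ e′∈ j (joins-sym j′))
  ... | _ | precolored e∈ j  | _ | inherited none     = contradiction (lose e∈ (joins-sym j)) none
  ... | _ | inherited none   | _ | precolored e′∈ j′ = contradiction (lose e′∈ (joins-sym j′)) none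
  ... | _ | inherited _      | _ | inherited _        = sym f x y p q

  overrideCol-proper : ∀ x y z (p : Adj x y) (q : Adj x z) → y ≢ z → overrideCol x y p ≢ overrideCol x z q
  overrideCol-proper x y z p q y≢z
    with overrideCol x y p | overrideView x y p | overrideCol x z q | overrideView x z q
  ... | _ | precolored e∈ j | _ | precolored e′∈ j′ = precolored-proper e∈ e′∈ j j′ p y≢z
  ... | _ | precolored e∈ j | _ | inherited _        = admissible-≢ f (φ-admissible e∈) j p q y≢z
  ... | _ | inherited _     | _ | precolored e′∈ j′ =
    admissible-≢ f (φ-admissible e′∈) j′ q p (y≢z ∘ ≡.sym) ∘ ≡.sym
  ... | _ | inherited _     | _ | inherited _        = proper f x y z p q y≢z

  overrideColoring : ProperEdgeColoring m t
  overrideColoring = record { col = overrideCol ; sym = overrideCol-sym ; proper = overrideCol-proper }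

  overrideColoring-extends : Extends overrideColoring φ
  overrideColoring-extends e e∈ with overrideCol (src e) (tgt e) (adj e) | overrideView (src e) (tgt e) (adj e)
  ... | _ | precolored e′∈ j = cong clr (precolored-unique e′∈ e∈ j (joins-self e))
  ... | _ | inherited none   = contradiction (lose e∈ (joins-self e)) none

  extendable : Extendable m t φ
  extendable = overrideColoring , overrideColoring-extends

extendable-viaAvoidingInjection : (c : Fin (suc m)) (σ : Fin m → Fin (suc m)) → AvoidingInjection c σ →
  (φ : List (PEdge m (suc m))) → IsPrecoloring φ →
  (∀ {e} → e ∈ φ → clr e ≡ c ⊎ σ (col baseColoring (src e) (tgt e) (adj e)) ≡ clr e) →
  Extendable m (suc m) φ
extendable-viaAvoidingInjection c σ (σ-injective , σ≢c) φ φ-precoloring coloredByσ =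
  Override.extendable (recolor σ σ-injective baseColoring) φ φ-precoloring admissible
  where
  admissible : ∀ {e} → e ∈ φ → Admissible (recolor σ σ-injective baseColoring) e
  admissible e∈ with coloredByσ e∈
  ... | inj₁ refl = inj₂ (λ x y p → σ≢c (col baseColoring x y p))
  ... | inj₂ byσ = inj₁ byσ

almostMonochromatic⇒extendable : (c : Fin (suc m)) (φ : List (PEdge m (suc m))) → IsPrecoloring φ →
  (∀ {e e′} → e ∈ φ → e′ ∈ φ → clr e ≢ c → clr e′ ≢ c → e ≡ e′) →
  Extendable m (suc m) φ
almostMonochromatic⇒extendable c φ φ-precoloring atMostOneOther with all? (λ e → clr e ≟ c) φ
... | yes allC = extendable-viaAvoidingInjection c (punchIn c) (punchIn-avoiding c) φ φ-precoloring
                   (inj₁ ∘ All.lookup allC)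
... | no notAllC with find (¬All⇒Any¬ (λ e → clr e ≟ c) φ notAllC)
...   | e₀ , e₀∈ , e₀≢c with avoidingInjection-sending (e₀≢c ∘ ≡.sym) (col baseColoring (src e₀) (tgt e₀) (adj e₀))
...     | σ , σ-avoiding , σe₀≡ = extendable-viaAvoidingInjection c σ σ-avoiding φ φ-precoloring classify
  where
  classify : ∀ {e} → e ∈ φ → clr e ≡ c ⊎ σ (col baseColoring (src e) (tgt e) (adj e)) ≡ clr e
  classify {e} e∈ with clr e ≟ c
  ... | yes e≡c = inj₁ e≡c
  ... | no e≢c with atMostOneOther e∈ e₀∈ e≢c e₀≢c
  ...   | refl = inj₂ σe₀≡

-- For n = suc k the number of colours 2n reduces to suc (2n ∸ 1).
lemma2p8 : (n : ℕ) → 2 ≤ n → (φ : List (PEdge (2 * n ∸ 1) (2 * n))) →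
    IsPrecoloring φ → length φ ≡ n + 1 →
    ∃ (λ (c : Fin (2 * n)) → n ≤ countColor c φ) →
    Extendable (2 * n ∸ 1) (2 * n) φ
lemma2p8 n@(suc _) _ φ φ-precoloring |φ|≡n+1 (c , n≤count) =
  almostMonochromatic⇒extendable c φ φ-precoloring
    (filter-rejects-atMostOne (λ e → clr e ≟ c) φ |φ|≤1+count)
  where
  |φ|≤1+count : length φ ≤ suc (countColor c φ)
  |φ|≤1+count = subst (_≤ suc (countColor c φ)) (≡.sym (trans |φ|≡n+1 (+-comm n 1))) (s≤s n≤count)
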